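{- For every integer $n\ge1$, \[ 2^n-1\le\sum_{i=1}^{n}|K_i| . \]
   Context: An expression is a formal term built from the symbol $x$ using the binary operations $+$ and $\cdot$ (with parentheses); its size is the number of occurrences of $x$ in it, and its value is the polynomial in $\mathbb{Z}[x]$ it computes. The values of expressions are exactly the nonzero polynomials with nonnegative integer coefficients and zero constant term. For such a polynomial $f$, its complexity $||f||$ is the minimum size of an expression whose value is $f$. For $n\ge1$, $K_n$ is the set of such polynomials $f$ with $||f||=n$. -}

module Defs where

open import Data.Nat using (ℕ; zero; suc; _+_; _*_; _≤_)
open import Data.List using (List; []; _∷_; map)
open import Data.Product using (Σ; _×_)
open import Relation.Binary.PropositionalEquality using (_≡_)

data Expr : Set where
  x   : Expr
  _⊕_ : Expr → Expr → Expr
  _⊗_ : Expr → Expr → Expr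

size : Expr → ℕ
size x       = 1
size (e ⊕ f) = size e + size f
size (e ⊗ f) = size e + size f

-- Polynomials in ℤ[x] with nonnegative coefficients, represented by the
-- canonical (normalised) coefficient list [c₀, c₁, …] with no trailing zeros.
Poly : Set
Poly = List ℕ

cons0 : ℕ → List ℕ → List ℕ
cons0 zero    [] = []
cons0 (suc a) [] = suc a ∷ []
cons0 a (b ∷ p)  = a ∷ b ∷ p

strip : List ℕ → List ℕ
strip []      = []
strip (a ∷ p) = cons0 a (strip p)

addP : List ℕ → List ℕ → List ℕ
addP []      q       = q
addP (a ∷ p) []      = a ∷ p
addP (a ∷ p) (b ∷ q) = (a + b) ∷ addP p q

mulP : List ℕ → List ℕ → List ℕ
mulP []      q = []
mulP (a ∷ p) q = addP (map (a *_) q) (0 ∷ mulP p q)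

val : Expr → Poly
val x       = 0 ∷ 1 ∷ []
val (e ⊕ f) = strip (addP (val e) (val f))
val (e ⊗ f) = strip (mulP (val e) (val f))

HasComplexity : Poly → ℕ → Set
HasComplexity f n =
  Σ Expr (λ e → size e ≡ n × val e ≡ f) × (∀ (e : Expr) → val e ≡ f → n ≤ size e)

K : ℕ → Poly → Set
K n f = HasComplexity f n

sumFrom1 : ℕ → (ℕ → ℕ) → ℕ
sumFrom1 zero    g = 0
sumFrom1 (suc n) g = sumFrom1 n g + g (suc n)

-- Each K_i is computed by enumerating all expressions of size at most i.  For the
-- bound, consider the 2^n - 1 left combs obtained from x by at most n - 1 steps,
-- each of which is "+ x" or "· x".  Their values are pairwise distinct: both steps
-- are injective on polynomials, "+ x" makes the coefficient of x positive while
-- "· x" makes it equal to the constant term, which is 0, and neither step can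
-- produce x itself.  A comb of size at most n lies in some K_i with i ≤ n, so
-- K_1 ∪ … ∪ K_n has at least 2^n - 1 elements.
module Submission where

open import Defs
open import Data.Nat using (ℕ; _≤_; _∸_; _^_)
open import Data.List using (List; length)
open import Data.List.Relation.Unary.Unique.Propositional using (Unique)
open import Data.List.Membership.Propositional using (_∈_)
open import Data.Product using (Σ; _×_)
open import Function.Bundles using (_⇔_)

open import Data.Nat using (zero; suc; _+_; _*_; _<_; _≤?_; z≤n; s≤s; s≤s⁻¹)
  renaming (_≟_ to _≟ℕ_)
open import Data.Nat.Properties
open import Data.List using ([]; _∷_; _++_; map; filter; cartesianProductWith; deduplicate)
open import Data.List.Properties using (≡-dec; length-++; length-++-sucʳ; length-map)
open import Data.List.Membership.Propositional.Properties
open import Data.List.Relation.Binary.Subset.Propositional using (_⊆_)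
open import Data.List.Relation.Binary.Disjoint.Propositional using (Disjoint)
open import Data.List.Relation.Unary.All as All using (All; []; _∷_)
import Data.List.Relation.Unary.All.Properties as All
open import Data.List.Relation.Unary.AllPairs using ([]; _∷_)
open import Data.List.Relation.Unary.Any using (here; there)
import Data.List.Relation.Unary.Unique.Propositional.Properties as Unique
open import Data.Product using (_,_; proj₂; ∃-syntax)
open import Data.Sum using (inj₁; inj₂)
open import Data.Empty using (⊥-elim)
open import Function.Base using (_∘_; const)
open import Function.Bundles using (mk⇔; Equivalence)
open import Relation.Binary.PropositionalEquality
open import Relation.Nullary using (¬_; yes; no; ¬?)
import Relation.Nullary.Decidable as Dec
open import Relation.Unary using (Decidable)

_≟P_ : (p q : Poly) → Dec.Dec (p ≡ q)
_≟P_ = ≡-dec _≟ℕ_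

open import Data.List.Membership.DecPropositional _≟P_ using (_∈?_)
open import Data.List.Relation.Unary.Unique.DecPropositional.Properties _≟P_ using (deduplicate-!)

open Equivalence

Unique-map⁺-on : ∀ {A B : Set} {P : A → Set} {f : A → B} →
                 (∀ {a b} → P a → P b → f a ≡ f b → a ≡ b) →
                 ∀ {xs} → All P xs → Unique xs → Unique (map f xs)
Unique-map⁺-on inj []        []          = []
Unique-map⁺-on inj (pa ∷ ps) (a∉xs ∷ xs!) =
  All.map⁺ (All.zipWith (λ (pb , a≢b) → a≢b ∘ inj pa pb) (ps , a∉xs))
  ∷ Unique-map⁺-on inj ps xs!

Unique-⊆⇒length≤ : ∀ {A : Set} {xs ys : List A} → Unique xs → xs ⊆ ys → length xs ≤ length ys
Unique-⊆⇒length≤ [] _ = z≤n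
Unique-⊆⇒length≤ {xs = a ∷ xs} (a∉xs ∷ xs!) xs⊆ys with ∈-∃++ (xs⊆ys (here refl))
... | ys₁ , ys₂ , refl = begin
    suc (length xs)            ≤⟨ s≤s (Unique-⊆⇒length≤ xs! xs⊆ys₁ys₂) ⟩
    suc (length (ys₁ ++ ys₂))  ≡⟨ length-++-sucʳ ys₁ a ys₂ ⟨
    length (ys₁ ++ a ∷ ys₂)    ∎
  where
  open ≤-Reasoning
  remove-a : ∀ {z} → z ∈ ys₁ ++ a ∷ ys₂ → a ≢ z → z ∈ ys₁ ++ ys₂
  remove-a z∈ a≢z with ∈-++⁻ ys₁ z∈
  ... | inj₁ z∈ys₁         = ∈-++⁺ˡ z∈ys₁
  ... | inj₂ (here z≡a)    = ⊥-elim (a≢z (sym z≡a))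
  ... | inj₂ (there z∈ys₂) = ∈-++⁺ʳ ys₁ z∈ys₂
  xs⊆ys₁ys₂ : xs ⊆ ys₁ ++ ys₂
  xs⊆ys₁ys₂ z∈xs = remove-a (xs⊆ys (there z∈xs)) (All.lookup a∉xs z∈xs)

coeff : List ℕ → ℕ → ℕ
coeff []      _       = 0
coeff (a ∷ p) zero    = a
coeff (a ∷ p) (suc k) = coeff p k

coeff-cons0 : ∀ a p → coeff (cons0 a p) ≗ coeff (a ∷ p)
coeff-cons0 zero    []      zero    = refl
coeff-cons0 zero    []      (suc k) = refl
coeff-cons0 (suc a) []      k       = refl
coeff-cons0 zero    (b ∷ p) k       = refl
coeff-cons0 (suc a) (b ∷ p) k       = refl

coeff-strip : ∀ p → coeff (strip p) ≗ coeff p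
coeff-strip []      k       = refl
coeff-strip (a ∷ p) zero    = coeff-cons0 a (strip p) zero
coeff-strip (a ∷ p) (suc k) = trans (coeff-cons0 a (strip p) (suc k)) (coeff-strip p k)

coeff-addP : ∀ p q k → coeff (addP p q) k ≡ coeff p k + coeff q k
coeff-addP []      q       k       = refl
coeff-addP (a ∷ p) []      k       = sym (+-identityʳ _)
coeff-addP (a ∷ p) (b ∷ q) zero    = refl
coeff-addP (a ∷ p) (b ∷ q) (suc k) = coeff-addP p q k

coeff≗0⇒strip≡[] : ∀ p → coeff p ≗ const 0 → strip p ≡ []
coeff≗0⇒strip≡[] []      _ = refl
coeff≗0⇒strip≡[] (a ∷ p) h rewrite h 0 | coeff≗0⇒strip≡[] p (h ∘ suc) = refl

coeff≗⇒strip≡ : ∀ p q → coeff p ≗ coeff q → strip p ≡ strip q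
coeff≗⇒strip≡ []      []      h = refl
coeff≗⇒strip≡ []      (b ∷ q) h rewrite sym (h 0) | coeff≗0⇒strip≡[] q (sym ∘ h ∘ suc) = refl
coeff≗⇒strip≡ (a ∷ p) []      h rewrite h 0 | coeff≗0⇒strip≡[] p (h ∘ suc) = refl
coeff≗⇒strip≡ (a ∷ p) (b ∷ q) h = cong₂ cons0 (h 0) (coeff≗⇒strip≡ p q (h ∘ suc))

strip-idem : ∀ p → strip (strip p) ≡ strip p
strip-idem p = coeff≗⇒strip≡ (strip p) p (coeff-strip p)

Normal : Poly → Set
Normal p = strip p ≡ p

Normal-ext : ∀ {p q} → Normal p → Normal q → coeff p ≗ coeff q → p ≡ q
Normal-ext {p} {q} p-normal q-normal h = trans (sym p-normal) (trans (coeff≗⇒strip≡ p q h) q-normal)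

X : Poly
X = val x

addX mulX : Poly → Poly
addX p = strip (addP p X)
mulX p = strip (mulP p X)

coeff-mulP-X-zero : ∀ p → coeff (mulP p X) 0 ≡ 0
coeff-mulP-X-zero []      = refl
coeff-mulP-X-zero (a ∷ p) = trans (+-identityʳ (a * 0)) (*-zeroʳ a)

coeff-mulP-X-suc : ∀ p k → coeff (mulP p X) (suc k) ≡ coeff p k
coeff-mulP-X-suc []      k       = refl
coeff-mulP-X-suc (a ∷ p) zero    = begin
  coeff (mulP (a ∷ p) X) 1    ≡⟨ coeff-addP (map (a *_) X) (0 ∷ mulP p X) 1 ⟩
  a * 1 + coeff (mulP p X) 0  ≡⟨ cong (a * 1 +_) (coeff-mulP-X-zero p) ⟩
  a * 1 + 0                   ≡⟨ +-identityʳ (a * 1) ⟩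
  a * 1                       ≡⟨ *-identityʳ a ⟩
  a                           ∎
  where open ≡-Reasoning
coeff-mulP-X-suc (a ∷ p) (suc k) =
  trans (coeff-addP (map (a *_) X) (0 ∷ mulP p X) (suc (suc k))) (coeff-mulP-X-suc p k)

coeff-addX : ∀ p k → coeff (addX p) k ≡ coeff p k + coeff X k
coeff-addX p k = trans (coeff-strip (addP p X) k) (coeff-addP p X k)

coeff-mulX-zero : ∀ p → coeff (mulX p) 0 ≡ 0
coeff-mulX-zero p = trans (coeff-strip (mulP p X) 0) (coeff-mulP-X-zero p)

coeff-mulX-suc : ∀ p k → coeff (mulX p) (suc k) ≡ coeff p k
coeff-mulX-suc p k = trans (coeff-strip (mulP p X) (suc k)) (coeff-mulP-X-suc p k)

coeff₁-addX≢0 : ∀ p → coeff (addX p) 1 ≢ 0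
coeff₁-addX≢0 p eq = m+1+n≢0 (coeff p 1) (trans (sym (coeff-addX p 1)) eq)

addX-injective : ∀ {p q} → Normal p → Normal q → addX p ≡ addX q → p ≡ q
addX-injective {p} {q} p-normal q-normal eq = Normal-ext p-normal q-normal λ k →
  +-cancelʳ-≡ (coeff X k) _ _
    (trans (sym (coeff-addX p k)) (trans (cong (λ r → coeff r k) eq) (coeff-addX q k)))

mulX-injective : ∀ {p q} → Normal p → Normal q → mulX p ≡ mulX q → p ≡ q
mulX-injective {p} {q} p-normal q-normal eq = Normal-ext p-normal q-normal λ k →
  trans (sym (coeff-mulX-suc p k)) (trans (cong (λ r → coeff r (suc k)) eq) (coeff-mulX-suc q k))

X≢addX : ∀ p {k} → coeff p k ≢ 0 → X ≢ addX p
X≢addX p {k} pₖ≢0 eq = pₖ≢0 (+-cancelʳ-≡ (coeff X k) (coeff p k) 0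
  (sym (trans (cong (λ r → coeff r k) eq) (coeff-addX p k))))

X≢mulX : ∀ p → coeff p 0 ≡ 0 → X ≢ mulX p
X≢mulX p p₀≡0 eq with trans (cong (λ r → coeff r 1) eq) (trans (coeff-mulX-suc p 0) p₀≡0)
... | ()

addX≢mulX : ∀ p q → coeff q 0 ≡ 0 → addX p ≢ mulX q
addX≢mulX p q q₀≡0 eq =
  coeff₁-addX≢0 p (trans (cong (λ r → coeff r 1) eq) (trans (coeff-mulX-suc q 0) q₀≡0))

size-pos : ∀ e → 0 < size e
size-pos x       = s≤s z≤n
size-pos (a ⊕ b) = <-≤-trans (size-pos a) (m≤m+n (size a) (size b))
size-pos (a ⊗ b) = <-≤-trans (size-pos a) (m≤m+n (size a) (size b))

operands-size≤ : ∀ a b {k} → size a + size b ≤ suc k → size a ≤ k × size b ≤ k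
operands-size≤ a b le =
  s≤s⁻¹ (<-≤-trans (m<m+n (size a) (size-pos b)) le) ,
  s≤s⁻¹ (<-≤-trans (m<n+m (size b) (size-pos a)) le)

-- All expressions of depth less than k, which include those of size at most k.
exprs : ℕ → List Expr
exprs zero    = []
exprs (suc k) = x ∷ cartesianProductWith _⊕_ (exprs k) (exprs k)
                  ++ cartesianProductWith _⊗_ (exprs k) (exprs k)

∈-exprs : ∀ e {k} → size e ≤ k → e ∈ exprs k
∈-exprs e       {zero}  le = ⊥-elim (<⇒≱ (size-pos e) le)
∈-exprs x       {suc k} le = here refl
∈-exprs (a ⊕ b) {suc k} le with operands-size≤ a b le
... | a≤k , b≤k = there (∈-++⁺ˡ (∈-cartesianProductWith⁺ _⊕_ (∈-exprs a a≤k) (∈-exprs b b≤k)))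
∈-exprs (a ⊗ b) {suc k} le with operands-size≤ a b le
... | a≤k , b≤k = there (∈-++⁺ʳ (cartesianProductWith _⊕_ (exprs k) (exprs k))
                          (∈-cartesianProductWith⁺ _⊗_ (∈-exprs a a≤k) (∈-exprs b b≤k)))

Realisable≤ : ℕ → Poly → Set
Realisable≤ k f = Σ Expr λ e → size e ≤ k × val e ≡ f

valuesUpTo : ℕ → List Poly
valuesUpTo k = map val (filter (λ e → size e ≤? k) (exprs k))

∈-valuesUpTo⇔ : ∀ k f → f ∈ valuesUpTo k ⇔ Realisable≤ k f
∈-valuesUpTo⇔ k f = mk⇔ to′ from′
  where
  to′ : f ∈ valuesUpTo k → Realisable≤ k f
  to′ f∈ with ∈-map⁻ val f∈
  ... | e , e∈ , f≡ = e , proj₂ (∈-filter⁻ (λ e → size e ≤? k) {xs = exprs k} e∈) , sym f≡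
  from′ : Realisable≤ k f → f ∈ valuesUpTo k
  from′ (e , le , refl) = ∈-map⁺ val (∈-filter⁺ (λ e → size e ≤? k) (∈-exprs e le) le)

realisable≤? : ∀ k → Decidable (Realisable≤ k)
realisable≤? k f = Dec.map (∈-valuesUpTo⇔ k f) (f ∈? valuesUpTo k)

K-suc⇔ : ∀ m f → K (suc m) f ⇔ (Realisable≤ (suc m) f × ¬ Realisable≤ m f)
K-suc⇔ m f = mk⇔ to′ from′
  where
  to′ : K (suc m) f → Realisable≤ (suc m) f × ¬ Realisable≤ m f
  to′ ((e , size≡ , val≡) , minimal) =
    (e , ≤-reflexive size≡ , val≡) , λ (e′ , le , val≡′) → <⇒≱ (minimal e′ val≡′) le
  from′ : Realisable≤ (suc m) f × ¬ Realisable≤ m f → K (suc m) f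
  from′ ((e , le , val≡) , new) = (e , ≤-antisym le (minimal e val≡) , val≡) , minimal
    where
    minimal : ∀ e′ → val e′ ≡ f → suc m ≤ size e′
    minimal e′ val≡′ = ≰⇒> (λ le′ → new (e′ , le′ , val≡′))

K-list : ℕ → List Poly
K-list zero    = []
K-list (suc m) = deduplicate _≟P_ (filter (¬? ∘ realisable≤? m) (valuesUpTo (suc m)))

∈-K-list⇔K : ∀ m f → f ∈ K-list (suc m) ⇔ K (suc m) f
∈-K-list⇔K m f = mk⇔ to′ from′
  where
  to′ : f ∈ K-list (suc m) → K (suc m) f
  to′ f∈ with ∈-filter⁻ (¬? ∘ realisable≤? m) (∈-deduplicate⁻ _≟P_ _ f∈)
  ... | f∈values , new = from (K-suc⇔ m f) (to (∈-valuesUpTo⇔ (suc m) f) f∈values , new)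
  from′ : K (suc m) f → f ∈ K-list (suc m)
  from′ f∈K with to (K-suc⇔ m f) f∈K
  ... | realisable , new = ∈-deduplicate⁺ _≟P_
    (∈-filter⁺ (¬? ∘ realisable≤? m) (from (∈-valuesUpTo⇔ (suc m) f) realisable) new)

K-list≤ : ℕ → List Poly
K-list≤ zero    = []
K-list≤ (suc n) = K-list≤ n ++ K-list (suc n)

length-K-list≤ : ∀ n → length (K-list≤ n) ≡ sumFrom1 n (length ∘ K-list)
length-K-list≤ zero    = refl
length-K-list≤ (suc n) =
  trans (length-++ (K-list≤ n)) (cong (_+ length (K-list (suc n))) (length-K-list≤ n))

realisable⇒∈-K-list≤ : ∀ n {f} → Realisable≤ n f → f ∈ K-list≤ n
realisable⇒∈-K-list≤ zero    (e , le , _) = ⊥-elim (<⇒≱ (size-pos e) le)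
realisable⇒∈-K-list≤ (suc n) {f} realisable with realisable≤? n f
... | yes earlier = ∈-++⁺ˡ (realisable⇒∈-K-list≤ n earlier)
... | no new      = ∈-++⁺ʳ (K-list≤ n) (from (∈-K-list⇔K n f) (from (K-suc⇔ n f) (realisable , new)))

record Admissible (p : Poly) : Set where
  constructor admissible
  field
    normal   : Normal p
    coeff₀≡0 : coeff p 0 ≡ 0
    nonzero  : ∃[ k ] coeff p k ≢ 0

open Admissible

X-admissible : Admissible X
X-admissible = admissible refl refl (1 , λ ())

addX-admissible : ∀ {p} → Admissible p → Admissible (addX p)
addX-admissible {p} p-adm = admissible (strip-idem (addP p X))
  (trans (coeff-addX p 0) (trans (+-identityʳ _) (coeff₀≡0 p-adm))) (1 , coeff₁-addX≢0 p)

mulX-admissible : ∀ {p} → Admissible p → Admissible (mulX p)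
mulX-admissible {p} p-adm with nonzero p-adm
... | k , pₖ≢0 = admissible (strip-idem (mulP p X)) (coeff-mulX-zero p)
  (suc k , pₖ≢0 ∘ trans (sym (coeff-mulX-suc p k)))

combValues : ℕ → List Poly
combValues zero    = []
combValues (suc n) = X ∷ map addX (combValues n) ++ map mulX (combValues n)

combValues-admissible : ∀ n → All Admissible (combValues n)
combValues-admissible zero    = []
combValues-admissible (suc n) = X-admissible ∷ All.++⁺
  (All.map⁺ (All.map addX-admissible (combValues-admissible n)))
  (All.map⁺ (All.map mulX-admissible (combValues-admissible n)))

combValues-unique : ∀ n → Unique (combValues n)
combValues-unique zero    = []
combValues-unique (suc n) = X-fresh ∷ Unique.++⁺
  (Unique-map⁺-on (λ p-adm q-adm → addX-injective (normal p-adm) (normal q-adm)) adm ps!)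
  (Unique-map⁺-on (λ p-adm q-adm → mulX-injective (normal p-adm) (normal q-adm)) adm ps!)
  sums#products
  where
  ps! : Unique (combValues n)
  ps! = combValues-unique n
  adm : All Admissible (combValues n)
  adm = combValues-admissible n
  X-fresh : All (X ≢_) (map addX (combValues n) ++ map mulX (combValues n))
  X-fresh = All.++⁺ (All.map⁺ (All.map (λ {p} p-adm → X≢addX p (proj₂ (nonzero p-adm))) adm))
                    (All.map⁺ (All.map (λ {p} p-adm → X≢mulX p (coeff₀≡0 p-adm)) adm))
  sums#products : Disjoint (map addX (combValues n)) (map mulX (combValues n))
  sums#products (v∈sums , v∈products) with ∈-map⁻ addX v∈sums | ∈-map⁻ mulX v∈products
  ... | p , _ , refl | q , q∈ , eq = addX≢mulX p q (coeff₀≡0 (All.lookup adm q∈)) eq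

length-combValues : ∀ n → suc (length (combValues n)) ≡ 2 ^ n
length-combValues zero    = refl
length-combValues (suc n) = begin
  suc (suc (length (map addX ps ++ map mulX ps)))  ≡⟨ cong (suc ∘ suc) (length-++ (map addX ps)) ⟩
  suc (suc (length (map addX ps) + length (map mulX ps)))
    ≡⟨ cong (suc ∘ suc) (cong₂ _+_ (length-map addX ps) (length-map mulX ps)) ⟩
  suc (suc (l + l))                                 ≡⟨ cong suc (+-suc l l) ⟨
  suc l + suc l                                     ≡⟨ cong (λ t → t + t) (length-combValues n) ⟩
  2 ^ n + 2 ^ n                                     ≡⟨ cong (2 ^ n +_) (+-identityʳ (2 ^ n)) ⟨
  2 ^ suc n                                         ∎
  where
  open ≡-Reasoning
  ps : List Poly
  ps = combValues n
  l : ℕ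
  l = length ps

combValues-realisable : ∀ n → All (Realisable≤ n) (combValues n)
combValues-realisable zero    = []
combValues-realisable (suc n) = (x , s≤s z≤n , refl) ∷ All.++⁺
  (All.map⁺ (All.map sum-step (combValues-realisable n)))
  (All.map⁺ (All.map product-step (combValues-realisable n)))
  where
  size-step : ∀ e → size e ≤ n → size e + 1 ≤ suc n
  size-step e le = ≤-trans (≤-reflexive (+-comm (size e) 1)) (s≤s le)
  sum-step : ∀ {p} → Realisable≤ n p → Realisable≤ (suc n) (addX p)
  sum-step (e , le , refl) = e ⊕ x , size-step e le , refl
  product-step : ∀ {p} → Realisable≤ n p → Realisable≤ (suc n) (mulX p)
  product-step (e , le , refl) = e ⊗ x , size-step e le , refl

proposition3p8 : (n : ℕ) → 1 ≤ n →
    Σ (ℕ → List Poly) (λ L →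
    ((i : ℕ) → 1 ≤ i → i ≤ n →
    Unique (L i) × ((f : Poly) → (f ∈ L i) ⇔ K i f))
    × (2 ^ n ∸ 1 ≤ sumFrom1 n (λ i → length (L i))))
proposition3p8 n _ = K-list , K-list-correct , count
  where
  K-list-correct : (i : ℕ) → 1 ≤ i → i ≤ n → Unique (K-list i) × ((f : Poly) → (f ∈ K-list i) ⇔ K i f)
  K-list-correct (suc m) _ _ = deduplicate-! _ , ∈-K-list⇔K m
  count : 2 ^ n ∸ 1 ≤ sumFrom1 n (λ i → length (K-list i))
  count = begin
    2 ^ n ∸ 1              ≡⟨ cong (_∸ 1) (length-combValues n) ⟨
    length (combValues n)  ≤⟨ Unique-⊆⇒length≤ (combValues-unique n)
                                (realisable⇒∈-K-list≤ n ∘ All.lookup (combValues-realisable n)) ⟩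
    length (K-list≤ n)     ≡⟨ length-K-list≤ n ⟩
    sumFrom1 n (λ i → length (K-list i)) ∎
    where open ≤-Reasoning
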